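{- Let $\mathbf G$ be an abelian group, $A,B\subseteq\mathbf G$, $X=\{x_1,\dots,x_t\}\subseteq\mathbf G$, $D=A-B$, and let $B_i\subseteq B$ for $i\in[t]$. Then $$A_X\subseteq D_{\bigcup_{i=1}^t(B_i+x_i)}.$$ In particular, $A_X\subseteq D_{B+X}$.
   Context: For $S,Y\subseteq\mathbf G$, $S_Y=\bigcap_{y\in Y}(S+y)$ (with $S_\emptyset=\mathbf G$). -}

module Defs where

open import Level using (Level; _⊔_)
open import Algebra.Bundles using (AbelianGroup)
open import Relation.Unary using (Pred)
open import Data.Product using (Σ; ∃; _×_)
open import Data.Nat using (ℕ)
open import Data.Fin using (Fin)

module _ {c ℓ} (G : AbelianGroup c ℓ) where
  open AbelianGroup G renaming (Carrier to 𝔾)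

  translate : ∀ {p} → Pred 𝔾 p → 𝔾 → Pred 𝔾 (c ⊔ ℓ ⊔ p)
  translate S y g = Σ 𝔾 λ s → S s × (g ≈ s ∙ y)

  -- S_Y = ⋂_{y ∈ Y} (S + y)   (equals G when Y is empty)
  shiftInter : ∀ {p q} → Pred 𝔾 p → Pred 𝔾 q → Pred 𝔾 (c ⊔ ℓ ⊔ p ⊔ q)
  shiftInter S Y g = ∀ y → Y y → translate S y g

  diffset : ∀ {p q} → Pred 𝔾 p → Pred 𝔾 q → Pred 𝔾 (c ⊔ ℓ ⊔ p ⊔ q)
  diffset A B g = Σ 𝔾 λ a → Σ 𝔾 λ b → A a × B b × (g ≈ a ∙ b ⁻¹)

  sumset : ∀ {p q} → Pred 𝔾 p → Pred 𝔾 q → Pred 𝔾 (c ⊔ ℓ ⊔ p ⊔ q)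
  sumset A B g = Σ 𝔾 λ a → Σ 𝔾 λ b → A a × B b × (g ≈ a ∙ b)

  finSet : {t : ℕ} → (Fin t → 𝔾) → Pred 𝔾 ℓ
  finSet {t} x g = Σ (Fin t) λ i → g ≈ x i

  unionTranslates : ∀ {r} {t : ℕ} → (Fin t → Pred 𝔾 r) → (Fin t → 𝔾) → Pred 𝔾 (c ⊔ ℓ ⊔ r)
  unionTranslates {t = t} Bs x g = Σ (Fin t) λ i → translate (Bs i) (x i) g

{-# OPTIONS --safe #-}
module Submission where

open import Defs
open import Algebra.Bundles using (AbelianGroup)
open import Relation.Unary using (Pred; _⊆_)
open import Data.Product using (_×_; _,_)
open import Data.Nat using (ℕ)
open import Data.Fin using (Fin)
open import Function using (id)
import Algebra.Properties.Group as GroupProperties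
import Relation.Binary.Reasoning.Setoid as SetoidReasoning

-- If g = a + z with a ∈ A, z ∈ X, and y = b + z with b ∈ B, then g = (a - b) + y ∈ D + y.
-- Hence A_X ⊆ D_Y whenever Y ⊆ B + X; both inclusions are instances of this.

module _ {c ℓ} (G : AbelianGroup c ℓ) where
  open AbelianGroup G renaming (Carrier to 𝔾)
  open GroupProperties group using (\\-leftDividesʳ)
  open SetoidReasoning setoid

  ∙-cancel-∙⁻¹ : ∀ a b z → (a ∙ b ⁻¹) ∙ (b ∙ z) ≈ a ∙ z
  ∙-cancel-∙⁻¹ a b z = begin
    (a ∙ b ⁻¹) ∙ (b ∙ z)   ≈⟨ assoc a (b ⁻¹) (b ∙ z) ⟩
    a ∙ (b ⁻¹ ∙ (b ∙ z))   ≈⟨ ∙-congˡ (\\-leftDividesʳ b z) ⟩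
    a ∙ z                  ∎

  translate-⊆-diffset : ∀ {p q} {A : Pred 𝔾 p} {B : Pred 𝔾 q} {b y z} →
                        B b → y ≈ b ∙ z →
                        translate G A z ⊆ translate G (diffset G A B) y
  translate-⊆-diffset {b = b} {y} {z} b∈B y≈b∙z {g} (a , a∈A , g≈a∙z) =
    a ∙ b ⁻¹ , (a , b , a∈A , b∈B , refl) , g≈a∙b⁻¹∙y
    where
    g≈a∙b⁻¹∙y : g ≈ (a ∙ b ⁻¹) ∙ y
    g≈a∙b⁻¹∙y = begin
      g                    ≈⟨ g≈a∙z ⟩
      a ∙ z                ≈⟨ ∙-cancel-∙⁻¹ a b z ⟨
      (a ∙ b ⁻¹) ∙ (b ∙ z) ≈⟨ ∙-congˡ y≈b∙z ⟨
      (a ∙ b ⁻¹) ∙ y       ∎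

  shiftInter-⊆-diffset : ∀ {p q r s} {A : Pred 𝔾 p} {B : Pred 𝔾 q}
                         {X : Pred 𝔾 r} {Y : Pred 𝔾 s} →
                         Y ⊆ sumset G B X →
                         shiftInter G A X ⊆ shiftInter G (diffset G A B) Y
  shiftInter-⊆-diffset Y⊆B+X g∈A_X y y∈Y with Y⊆B+X y∈Y
  ... | b , z , b∈B , z∈X , y≈b∙z = translate-⊆-diffset b∈B y≈b∙z (g∈A_X z z∈X)

  unionTranslates-⊆-sumset : ∀ {q r} {B : Pred 𝔾 q} {t : ℕ}
                             {Bs : Fin t → Pred 𝔾 r} {x : Fin t → 𝔾} →
                             (∀ i → Bs i ⊆ B) →
                             unionTranslates G Bs x ⊆ sumset G B (finSet G x)
  unionTranslates-⊆-sumset Bs⊆B (i , b , b∈Bsᵢ , y≈b∙xᵢ) =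
    b , _ , Bs⊆B i b∈Bsᵢ , (i , refl) , y≈b∙xᵢ

lemma10 : ∀ {c ℓ p q r} (G : AbelianGroup c ℓ)
            (A : Pred (AbelianGroup.Carrier G) p) (B : Pred (AbelianGroup.Carrier G) q)
            (t : ℕ) (x : Fin t → AbelianGroup.Carrier G)
            (Bs : Fin t → Pred (AbelianGroup.Carrier G) r) →
            (∀ i → Bs i ⊆ B) →
            (shiftInter G A (finSet G x) ⊆ shiftInter G (diffset G A B) (unionTranslates G Bs x))
            × (shiftInter G A (finSet G x) ⊆ shiftInter G (diffset G A B) (sumset G B (finSet G x)))
lemma10 G A B t x Bs Bs⊆B =
  shiftInter-⊆-diffset G (unionTranslates-⊆-sumset G Bs⊆B) ,
  shiftInter-⊆-diffset G id
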